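{- Let $\alpha\ge1$, $\beta\ge1$ be fixed integers. On a sorted array $V=(v_0<\dots<v_{n-1})$ with $n\ge1$ items (with $O(1)$-time access to each item) and a value $x\in V$, the $(\alpha,\beta)$ Fibonacci search algorithm, including the computation of the needed values of $G$, runs in time $O(\log n)$.
   Context: Let $\ell=\min\{\alpha,\beta\}$. Define $g(k)=0$ for $k<0$, $g(0)=1$, $g(k)=g(k-\alpha)+g(k-\beta)$ for $k\ge1$, and $G(k)=\sum_{i=1}^{\ell} g(k+1-i)$. A comparison "$x\le v_j$?" costs $\alpha$ if true and $\beta$ if false. The $(\alpha,\beta)$ Fibonacci search algorithm: compute $G(0),G(1),\dots$ up to $k=\min\{j\ge0: G(j)\ge n\}$; set $z=k-\alpha$, $left=0$, $right=n-1$; while $left<right$: set $index=\min(left+G(z)-1,\,right)$, compare $x\le v_{index}$; if true set $right=index$ and $z=z-\alpha$, otherwise set $left=index+1$ and $z=z-\beta$. On exit the output position is $left$. Running time is measured with unit-cost arithmetic operations and comparisons. -}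

module Defs where

open import Level using (Level)
open import Data.Nat using (ℕ; zero; suc; _+_; _*_; _∸_; _⊓_; _≤?_; _<?_)
open import Data.Integer as ℤ using (ℤ; +_; -[1+_])
open import Data.Fin using (Fin; toℕ; fromℕ<)
open import Data.Vec using (Vec; lookup)
open import Data.List using (List; map; upTo)
open import Data.Nat.ListAction using (sum)
open import Data.Maybe using (Maybe; just; nothing)
open import Data.Product using (_×_; _,_; ∃)
open import Relation.Nullary using (yes; no)
open import Relation.Binary.Bundles using (StrictTotalOrder)
open import Relation.Binary.Definitions using (tri<; tri≈; tri>)
open import Data.Bool using (Bool; true; false; if_then_else_)

module _ (α β : ℕ) where

  ℓ : ℕ
  ℓ = α ⊓ β

  -- g with an explicit recursion budget; for α, β ≥ 1 a budget of (suc k) is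
  -- always sufficient, since each recursive call decreases the argument.
  -- Arguments below 0 (i.e. k - α < 0) give 0.
  gF : ℕ → ℕ → ℕ
  gF zero     _       = 0
  gF (suc f)  zero    = 1
  gF (suc f) (suc m)  = term α + term β
    where
      term : ℕ → ℕ
      term a with a Data.Nat.≤? suc m
      ... | yes _ = gF f (suc m ∸ a)
      ... | no  _ = 0

  g : ℕ → ℕ
  g k = gF (suc k) k

  gℤ : ℤ → ℕ
  gℤ (+ k)    = g k
  gℤ -[1+ _ ] = 0

  -- G(k) = Σ_{i=1}^{ℓ} g(k+1-i) = Σ_{i'=0}^{ℓ-1} g(k - i')
  G : ℤ → ℕ
  G k = sum (map (λ i → gℤ (k ℤ.- + i)) (upTo ℓ))

  -- Computing the table entry for index j (g(j) from stored values: 2 index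
  -- subtractions, 2 sign tests, 1 addition; G(j) as a sum of ℓ stored g-values:
  -- ℓ index computations and ℓ additions; the test G(j) ≥ n; the increment of j):
  precompStepCost : ℕ
  precompStepCost = 2 * ℓ + 7

  -- One iteration of the while loop (test left<right, left+G(z)-1 (2 ops),
  -- the min (1 comparison), the comparison x ≤ v_index, update of left/right,
  -- update of z):
  iterCost : ℕ
  iterCost = 7

  -- Computes G(0), G(1), … until G(j) ≥ n; returns (k , accumulated cost).
  -- First argument is a fuel bound (nothing = ran out of fuel).
  findK : ℕ → (n j cost : ℕ) → Maybe (ℕ × ℕ)
  findK zero     n j c = nothing
  findK (suc f)  n j c with n ≤? G (+ j)
  ... | yes _ = just (j , c + precompStepCost)
  ... | no  _ = findK f n (suc j) (c + precompStepCost)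

  module _ {a r s : Level} (O : StrictTotalOrder a r s) where
    open StrictTotalOrder O using (compare; _<_; _≈_) renaming (Carrier to A)

    leq? : A → A → Bool
    leq? x v with compare x v
    ... | tri< _ _ _ = true
    ... | tri≈ _ _ _ = true
    ... | tri> _ _ _ = false

    -- The while loop; returns (output position left , total cost).
    searchLoop : ℕ → {n : ℕ} → Vec A n → A → (left right : ℕ) → ℤ → ℕ → Maybe (ℕ × ℕ)
    searchLoop zero V x left right z c = nothing
    searchLoop (suc f) {n} V x left right z c with left <? right
    ... | no  _ = just (left , c + 1)
    ... | yes _ with ((left + G z) ∸ 1) ⊓ right <? n
    ...   | no  _ = nothing
    ...   | yes p =
      let index = ((left + G z) ∸ 1) ⊓ right in
      if leq? x (lookup V (fromℕ< p))
        then searchLoop f V x left index (z ℤ.- + α) (c + iterCost)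
        else searchLoop f V x (suc index) right (z ℤ.- + β) (c + iterCost)

    -- The whole (α,β) Fibonacci search, including computing G(0..k).
    -- Initialisation (z = k - α, right = n - 1) is charged 2.
    fibSearch : ℕ → {n : ℕ} → Vec A n → A → Maybe (ℕ × ℕ)
    fibSearch fuel {n} V x with findK fuel n 0 0
    ... | nothing      = nothing
    ... | just (k , c) = searchLoop fuel V x 0 (n ∸ 1) (+ k ℤ.- + α) (c + 2)

    SortedVec : {n : ℕ} → Vec A n → Set s
    SortedVec {n} V = (i j : Fin n) → toℕ i Data.Nat.< toℕ j → lookup V i < lookup V j

    InVec : {n : ℕ} → A → Vec A n → Set r
    InVec {n} x V = ∃ λ (i : Fin n) → lookup V i ≈ x

module Submission where

-- First the numbers G(m) behave like a
-- Fibonacci sequence: G(m) = 1 for 0 ≤ m < ℓ, G(m) = 0 for m < 0 and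
-- G(m) = G(m-α) + G(m-β) for m ≥ ℓ.  Hence G(m) ≥ 1 always, and every
-- block of α+β indices doubles G, so G((1+L)(α+β)) ≥ 2^(1+L) > n for
-- L = ⌊log₂ n⌋.  Consequently the precomputation stops at some
-- k ≤ (1+L)(α+β), having paid one step cost per table entry.
--
-- Second, the while loop keeps the invariant "z = m - α and the window
-- [left,right] has at most G(m) items".  A comparison splits a window of
-- size G(m) = G(m-α) + G(m-β) into windows of sizes G(m-α) and G(m-β),
-- so m drops by at least one per iteration and the loop makes at most k
-- iterations.  Adding the two costs gives a bound linear in L.

open import Defs
open import Level using (Level)
open import Data.Nat
open import Data.Nat.Properties
open import Data.Nat.Induction using (<-rec)
open import Data.Nat.Logarithm using (⌊log₂_⌋; ⌊log₂⌋-mono-≤; ⌊log₂[2^n]⌋≡n)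
import Data.Nat.Tactic.RingSolver as ℕ-Solver
open import Data.Integer as ℤ using (ℤ; +_; -[1+_]; 0ℤ; +<+)
import Data.Integer.Properties as ℤP
import Data.Integer.Tactic.RingSolver as ℤ-Solver
open import Data.List using (map; applyUpTo)
open import Data.Nat.ListAction using (sum)
open import Data.Vec using (Vec; lookup)
open import Data.Fin using (fromℕ<)
open import Data.Bool using (true; false)
open import Data.Maybe using (just)
open import Data.Product using (∃; ∃₂; _×_; _,_)
open import Data.Sum using (_⊎_; inj₁; inj₂)
open import Data.Empty using (⊥-elim)
open import Function using (_∘_; id)
open import Relation.Nullary using (¬_; yes; no)
open import Relation.Binary.Bundles using (StrictTotalOrder)
open import Relation.Binary.Definitions using (tri<; tri≈; tri>)
open import Relation.Binary.PropositionalEquality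

∸-shrinks : ∀ {m a} → 1 ≤ a → 1 ≤ m → m ∸ a < m
∸-shrinks {suc m} {suc a} _ _ = s≤s (m∸n≤m m a)

cancel-prefix : ∀ a b → (a + b ∸ 1) ∸ a ≡ b ∸ 1
cancel-prefix a b = begin
  (a + b ∸ 1) ∸ a   ≡⟨ ∸-+-assoc (a + b) 1 a ⟩
  a + b ∸ (1 + a)   ≡⟨ cong (a + b ∸_) (+-comm 1 a) ⟩
  a + b ∸ (a + 1)   ≡⟨ sym (∸-+-assoc (a + b) a 1) ⟩
  (a + b ∸ a) ∸ 1   ≡⟨ cong (_∸ 1) (m+n∸m≡n a b) ⟩
  b ∸ 1             ∎
  where open ≡-Reasoning

-- Window arithmetic of one search step probing index = min(left+g-1, right):
-- the left part [left,index] has at most g items, the right part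
-- [index+1,right] at most (right-left+1) - g items.
left-window : ∀ left right g → ((left + g) ∸ 1) ⊓ right ∸ left ≤ g ∸ 1
left-window left right g =
  ≤-trans (∸-monoˡ-≤ left (m⊓n≤m _ right)) (≤-reflexive (cancel-prefix left g))

right-window : ∀ left right g → right ∸ suc (((left + g) ∸ 1) ⊓ right) ≤ (right ∸ left) ∸ g
right-window left right g = begin
  right ∸ (suc (left + g ∸ 1) ⊓ suc right)
    ≡⟨ ∸-distribˡ-⊓-⊔ right (suc (left + g ∸ 1)) (suc right) ⟩
  (right ∸ suc (left + g ∸ 1)) ⊔ (right ∸ suc right)
    ≡⟨ cong ((right ∸ suc (left + g ∸ 1)) ⊔_) (m≤n⇒m∸n≡0 (n≤1+n right)) ⟩
  (right ∸ suc (left + g ∸ 1)) ⊔ 0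
    ≡⟨ ⊔-identityʳ _ ⟩
  right ∸ suc (left + g ∸ 1)
    ≤⟨ ∸-monoʳ-≤ right (m≤n+m∸n (left + g) 1) ⟩
  right ∸ (left + g)
    ≡⟨ sym (∸-+-assoc right left g) ⟩
  (right ∸ left) ∸ g ∎
  where open ≤-Reasoning

-- Widths are stored as right - left (one less than the item count): if a
-- window has at most g+h items, dropping its first g leaves at most h.
split-width : ∀ w g h → w ≤ (g + h) ∸ 1 → w ∸ g ≤ h ∸ 1
split-width w g h w≤ = ≤-trans (∸-monoˡ-≤ g w≤) (≤-reflexive (cancel-prefix g h))

below-next-power : ∀ n → n < 2 ^ suc ⌊log₂ n ⌋
below-next-power n with 2 ^ suc ⌊log₂ n ⌋ ≤? n
... | no  n≱ = ≰⇒> n≱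
... | yes big = ⊥-elim (<⇒≱ (n<1+n _) (subst (_≤ ⌊log₂ n ⌋) (⌊log₂[2^n]⌋≡n (suc ⌊log₂ n ⌋)) (⌊log₂⌋-mono-≤ big)))

minus-≥ : ∀ {m a} → a ≤ m → + m ℤ.- + a ≡ + (m ∸ a)
minus-≥ {m} {a} a≤m = trans (ℤP.m-n≡m⊖n m a) (ℤP.⊖-≥ a≤m)

minus-< : ∀ {m a} → m < a → + m ℤ.- + a ℤ.< 0ℤ
minus-< {m} {a} m<a =
  subst (ℤ._< 0ℤ) (sym (trans (ℤP.m-n≡m⊖n m a) (ℤP.⊖-< m<a)))
        (ℤP.neg-mono-< (+<+ (m<n⇒0<n∸m m<a)))

minus-comm : ∀ (w a b : ℤ) → (w ℤ.- a) ℤ.- b ≡ (w ℤ.- b) ℤ.- a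
minus-comm = ℤ-Solver.solve-∀

-- Finite sums  sumBelow n F = F 0 + F 1 + … + F (n-1), peeled from the
-- front exactly as applyUpTo builds its list.

sumBelow : ℕ → (ℕ → ℕ) → ℕ
sumBelow zero    F = 0
sumBelow (suc n) F = F 0 + sumBelow n (F ∘ suc)

sum-applyUpTo : ∀ (f h : ℕ → ℕ) n → sum (map f (applyUpTo h n)) ≡ sumBelow n (f ∘ h)
sum-applyUpTo f h zero    = refl
sum-applyUpTo f h (suc n) = cong (_+_ (f (h 0))) (sum-applyUpTo f (h ∘ suc) n)

sumBelow-cong : ∀ n {F H} → (∀ i → i < n → F i ≡ H i) → sumBelow n F ≡ sumBelow n H
sumBelow-cong zero    eq = refl
sumBelow-cong (suc n) eq = cong₂ _+_ (eq 0 z<s) (sumBelow-cong n (λ i i<n → eq (suc i) (s<s i<n)))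

sumBelow-+ : ∀ n F H → sumBelow n (λ i → F i + H i) ≡ sumBelow n F + sumBelow n H
sumBelow-+ zero    F H = refl
sumBelow-+ (suc n) F H = begin
  (F 0 + H 0) + sumBelow n (λ i → F (suc i) + H (suc i))
    ≡⟨ cong (_+_ (F 0 + H 0)) (sumBelow-+ n (F ∘ suc) (H ∘ suc)) ⟩
  (F 0 + H 0) + (sumBelow n (F ∘ suc) + sumBelow n (H ∘ suc))
    ≡⟨ +-interchange (F 0) (H 0) (sumBelow n (F ∘ suc)) (sumBelow n (H ∘ suc)) ⟩
  (F 0 + sumBelow n (F ∘ suc)) + (H 0 + sumBelow n (H ∘ suc)) ∎
  where
  open ≡-Reasoning
  +-interchange : ∀ a b c d → (a + b) + (c + d) ≡ (a + c) + (b + d)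
  +-interchange = ℕ-Solver.solve-∀

sumBelow-zero : ∀ n {F} → (∀ i → i < n → F i ≡ 0) → sumBelow n F ≡ 0
sumBelow-zero zero    _  = refl
sumBelow-zero (suc n) eq rewrite eq 0 z<s = sumBelow-zero n (λ i i<n → eq (suc i) (s<s i<n))

sumBelow-single : ∀ n F m → m < n → (∀ i → i < n → i ≢ m → F i ≡ 0) → sumBelow n F ≡ F m
sumBelow-single (suc n) F zero    _         others =
  trans (cong (_+_ (F 0)) (sumBelow-zero n (λ i i<n → others (suc i) (s<s i<n) (λ ())))) (+-identityʳ (F 0))
sumBelow-single (suc n) F (suc m) (s≤s m<n) others =
  trans (cong (λ t → t + sumBelow n (F ∘ suc)) (others 0 z<s (λ ())))
        (sumBelow-single n (F ∘ suc) m m<n (λ i i<n i≢m → others (suc i) (s<s i<n) (i≢m ∘ suc-injective)))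

module FibonacciSearch (α β : ℕ) (1≤α : 1 ≤ α) (1≤β : 1 ≤ β) where

  ℓ≤α : ℓ α β ≤ α
  ℓ≤α = m⊓n≤m α β

  ℓ≤β : ℓ α β ≤ β
  ℓ≤β = m⊓n≤n α β

  1≤ℓ : 1 ≤ ℓ α β
  1≤ℓ = ⊓-glb 1≤α 1≤β

  some-step-fits : ∀ {m} → ℓ α β ≤ m → α ≤ m ⊎ β ≤ m
  some-step-fits ℓ≤m with ⊓-sel α β
  ... | inj₁ ℓ≡α = inj₁ (subst (_≤ _) ℓ≡α ℓ≤m)
  ... | inj₂ ℓ≡β = inj₂ (subst (_≤ _) ℓ≡β ℓ≤m)

  -- The recurrence for g.  g is defined with a fuel argument, so we first
  -- check that any sufficient amount of fuel yields the same value.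

  call-fits : ∀ {a m f} → 1 ≤ a → suc m ≤ f → suc m ∸ a < f
  call-fits 1≤a m<f = <-≤-trans (∸-shrinks 1≤a z<s) m<f

  gF-stable : ∀ f f' m → m < f → m < f' → gF α β f m ≡ gF α β f' m
  gF-stable (suc f) (suc f') zero    _         _          = refl
  gF-stable (suc f) (suc f') (suc m) (s≤s m<f) (s≤s m<f') with α ≤? suc m | β ≤? suc m
  ... | yes _ | yes _ = cong₂ _+_ (gF-stable f f' _ (call-fits 1≤α m<f) (call-fits 1≤α m<f'))
                                  (gF-stable f f' _ (call-fits 1≤β m<f) (call-fits 1≤β m<f'))
  ... | yes _ | no _  = cong (λ t → t + 0) (gF-stable f f' _ (call-fits 1≤α m<f) (call-fits 1≤α m<f'))
  ... | no _  | yes _ = gF-stable f f' _ (call-fits 1≤β m<f) (call-fits 1≤β m<f')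
  ... | no _  | no _  = refl

  gℤ-negative : ∀ {w} → w ℤ.< 0ℤ → gℤ α β w ≡ 0
  gℤ-negative { -[1+ _ ]} _        = refl
  gℤ-negative {+ _}      (+<+ ())

  term-in-range : ∀ {a} k → 1 ≤ a → a ≤ suc k → gF α β (suc k) (suc k ∸ a) ≡ gℤ α β (+ suc k ℤ.- + a)
  term-in-range k 1≤a a≤ =
    trans (gF-stable _ _ _ (∸-shrinks 1≤a z<s) ≤-refl) (cong (gℤ α β) (sym (minus-≥ a≤)))

  term-out-of-range : ∀ {a} k → ¬ a ≤ suc k → 0 ≡ gℤ α β (+ suc k ℤ.- + a)
  term-out-of-range k a≰ = sym (gℤ-negative (minus-< (≰⇒> a≰)))

  g-rec : ∀ {w} → 0ℤ ℤ.< w → gℤ α β w ≡ gℤ α β (w ℤ.- + α) + gℤ α β (w ℤ.- + β)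
  g-rec {+ zero} (+<+ ())
  g-rec {+ suc k} _ with α ≤? suc k | β ≤? suc k
  ... | yes α≤ | yes β≤ = cong₂ _+_ (term-in-range k 1≤α α≤) (term-in-range k 1≤β β≤)
  ... | yes α≤ | no β≰  = cong₂ _+_ (term-in-range k 1≤α α≤) (term-out-of-range k β≰)
  ... | no α≰  | yes β≤ = cong₂ _+_ (term-out-of-range k α≰) (term-in-range k 1≤β β≤)
  ... | no α≰  | no β≰  = cong₂ _+_ (term-out-of-range k α≰) (term-out-of-range k β≰)

  -- g vanishes strictly between 0 and ℓ, since both recursive calls are negative.
  g-below-ℓ : ∀ {j} → 0 < j → j < ℓ α β → gℤ α β (+ j) ≡ 0
  g-below-ℓ 0<j j<ℓ = trans (g-rec (+<+ 0<j))
    (cong₂ _+_ (gℤ-negative (minus-< (<-≤-trans j<ℓ ℓ≤α))) (gℤ-negative (minus-< (<-≤-trans j<ℓ ℓ≤β))))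

  G-as-sum : ∀ w → G α β w ≡ sumBelow (ℓ α β) (λ i → gℤ α β (w ℤ.- + i))
  G-as-sum w = sum-applyUpTo _ id (ℓ α β)

  G-negative : ∀ {w} → w ℤ.< 0ℤ → G α β w ≡ 0
  G-negative {w} w<0 = trans (G-as-sum w)
    (sumBelow-zero (ℓ α β) (λ i _ → gℤ-negative (ℤP.≤-<-trans (ℤP.i-j≤i w (+ i)) w<0)))

  G-minus : ∀ {m a} → a ≤ m → G α β (+ m ℤ.- + a) ≡ G α β (+ (m ∸ a))
  G-minus a≤m = cong (G α β) (minus-≥ a≤m)

  G-initial : ∀ {m} → m < ℓ α β → G α β (+ m) ≡ 1
  G-initial {m} m<ℓ = trans (G-as-sum (+ m))
    (trans (sumBelow-single (ℓ α β) _ m m<ℓ others) diagonal)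
    where
    diagonal : gℤ α β (+ m ℤ.- + m) ≡ 1
    diagonal = cong (gℤ α β) (trans (minus-≥ {m} {m} ≤-refl) (cong +_ (n∸n≡0 m)))
    others : ∀ i → i < ℓ α β → i ≢ m → gℤ α β (+ m ℤ.- + i) ≡ 0
    others i i<ℓ i≢m with <-cmp i m
    ... | tri< i<m _ _ = trans (cong (gℤ α β) (minus-≥ (<⇒≤ i<m)))
                               (g-below-ℓ (m<n⇒0<n∸m i<m) (≤-<-trans (m∸n≤m m i) m<ℓ))
    ... | tri≈ _ i≡m _ = ⊥-elim (i≢m i≡m)
    ... | tri> _ _ m<i = gℤ-negative (minus-< m<i)

  G-rec : ∀ {m} → ℓ α β ≤ m → G α β (+ m) ≡ G α β (+ m ℤ.- + α) + G α β (+ m ℤ.- + β)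
  G-rec {m} ℓ≤m = begin
    G α β (+ m)
      ≡⟨ G-as-sum (+ m) ⟩
    sumBelow (ℓ α β) (λ i → gℤ α β (+ m ℤ.- + i))
      ≡⟨ sumBelow-cong (ℓ α β) pointwise ⟩
    sumBelow (ℓ α β) (λ i → gℤ α β ((+ m ℤ.- + α) ℤ.- + i) + gℤ α β ((+ m ℤ.- + β) ℤ.- + i))
      ≡⟨ sumBelow-+ (ℓ α β) _ _ ⟩
    sumBelow (ℓ α β) (λ i → gℤ α β ((+ m ℤ.- + α) ℤ.- + i)) + sumBelow (ℓ α β) (λ i → gℤ α β ((+ m ℤ.- + β) ℤ.- + i))
      ≡⟨ sym (cong₂ _+_ (G-as-sum (+ m ℤ.- + α)) (G-as-sum (+ m ℤ.- + β))) ⟩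
    G α β (+ m ℤ.- + α) + G α β (+ m ℤ.- + β) ∎
    where
    open ≡-Reasoning
    -- each term of the window obeys the recurrence of g, because i < ℓ ≤ m
    pointwise : ∀ i → i < ℓ α β → gℤ α β (+ m ℤ.- + i) ≡ gℤ α β ((+ m ℤ.- + α) ℤ.- + i) + gℤ α β ((+ m ℤ.- + β) ℤ.- + i)
    pointwise i i<ℓ
      rewrite minus-comm (+ m) (+ α) (+ i) | minus-comm (+ m) (+ β) (+ i) =
      g-rec (subst (0ℤ ℤ.<_) (sym (minus-≥ (<⇒≤ i<m))) (+<+ (m<n⇒0<n∸m i<m)))
      where
      i<m : i < m
      i<m = <-≤-trans i<ℓ ℓ≤m

  G-positive : ∀ m → 1 ≤ G α β (+ m)
  G-positive = <-rec (λ m → 1 ≤ G α β (+ m)) step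
    where
    step : ∀ m → (∀ {k} → k < m → 1 ≤ G α β (+ k)) → 1 ≤ G α β (+ m)
    step m ih with m <? ℓ α β
    ... | yes m<ℓ = ≤-reflexive (sym (G-initial m<ℓ))
    ... | no m≮ℓ = subst (1 ≤_) (sym (G-rec ℓ≤m)) (some-summand (some-step-fits ℓ≤m))
      where
      ℓ≤m : ℓ α β ≤ m
      ℓ≤m = ≮⇒≥ m≮ℓ
      summand : ∀ {a} → 1 ≤ a → a ≤ m → 1 ≤ G α β (+ m ℤ.- + a)
      summand 1≤a a≤m = subst (1 ≤_) (sym (G-minus a≤m)) (ih (∸-shrinks 1≤a (≤-trans 1≤ℓ ℓ≤m)))
      some-summand : α ≤ m ⊎ β ≤ m → 1 ≤ G α β (+ m ℤ.- + α) + G α β (+ m ℤ.- + β)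
      some-summand (inj₁ α≤m) = ≤-trans (summand 1≤α α≤m) (m≤m+n _ _)
      some-summand (inj₂ β≤m) = ≤-trans (summand 1≤β β≤m) (m≤n+m _ _)

  G-doubles : ∀ q m → q * (α + β) ≤ m → 2 ^ q ≤ G α β (+ m)
  G-doubles zero    m _  = G-positive m
  G-doubles (suc q) m bound = begin
    2 ^ suc q                                   ≡⟨ cong (_+_ (2 ^ q)) (+-identityʳ (2 ^ q)) ⟩
    2 ^ q + 2 ^ q                               ≤⟨ +-mono-≤ (after α (m≤m+n α β)) (after β (m≤n+m β α)) ⟩
    G α β (+ (m ∸ α)) + G α β (+ (m ∸ β))       ≡⟨ sym (cong₂ _+_ (G-minus (fits α (m≤m+n α β))) (G-minus (fits β (m≤n+m β α)))) ⟩
    G α β (+ m ℤ.- + α) + G α β (+ m ℤ.- + β)   ≡⟨ sym (G-rec (≤-trans ℓ≤α (fits α (m≤m+n α β)))) ⟩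
    G α β (+ m)                                 ∎
    where
    open ≤-Reasoning
    fits : ∀ a → a ≤ α + β → a ≤ m
    fits a a≤ = ≤-trans a≤ (m+n≤o⇒m≤o (α + β) bound)
    after : ∀ a → a ≤ α + β → 2 ^ q ≤ G α β (+ (m ∸ a))
    after a a≤ = G-doubles q (m ∸ a)
      (m+n≤o⇒m≤o∸n (q * (α + β)) (≤-trans (≤-reflexive (+-comm _ a)) (≤-trans (+-monoˡ-≤ _ a≤) bound)))

  findK-finds : ∀ f n j c d → n ≤ G α β (+ (j + d)) → d < f →
    ∃ λ e → e ≤ d × n ≤ G α β (+ (j + e)) ×
      findK α β f n j c ≡ just (j + e , c + suc e * precompStepCost α β)
  findK-finds (suc f) n j c d n≤G (s≤s d≤f) with n ≤? G α β (+ j)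
  ... | yes n≤Gj = 0 , z≤n , subst (λ t → n ≤ G α β (+ t)) (sym (+-identityʳ j)) n≤Gj ,
                   cong₂ (λ k c' → just (k , c')) (sym (+-identityʳ j)) (cong (_+_ c) (sym (*-identityˡ _)))
  findK-finds (suc f) n j c zero    n≤G _ | no n≰Gj =
    ⊥-elim (n≰Gj (subst (λ t → n ≤ G α β (+ t)) (+-identityʳ j) n≤G))
  findK-finds (suc f) n j c (suc d) n≤G (s≤s d<f) | no _
    with findK-finds f n (suc j) (c + precompStepCost α β) d
           (subst (λ t → n ≤ G α β (+ t)) (+-suc j d) n≤G) d<f
  ... | e , e≤d , n≤Gk , found rewrite sym (+-suc j e) =
    suc e , s≤s e≤d , n≤Gk , trans found (cong (λ c' → just (j + suc e , c')) (+-assoc c _ _))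

  C : ℕ
  C = (2 * (α + β) + 1) * (precompStepCost α β + 7) + 3

  -- If the precomputation stops at e ≤ (1+L)(α+β), the table has at most
  -- L(2(α+β)+1) entries …
  entries-bound : ∀ e L → 1 ≤ L → e ≤ suc L * (α + β) → suc e ≤ L * (2 * (α + β) + 1)
  entries-bound e (suc t) _ e≤ =
    ≤-trans (s≤s e≤) (≤-trans (m≤m+n _ (t + t * (α + β))) (≤-reflexive (regroup t (α + β))))
    where
    regroup : ∀ t M → suc (suc (suc t) * M) + (t + t * M) ≡ suc t * (2 * M + 1)
    regroup = ℕ-Solver.solve-∀

  -- … so precomputing them (step cost P each), initialising (2), exiting (1)
  -- and running at most e iterations (7 each) costs at most C·L.
  total-cost : ∀ e L → 1 ≤ L → e ≤ suc L * (α + β) →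
    suc e * precompStepCost α β + 2 + 1 + 7 * e ≤ C * L
  total-cost e L 1≤L e≤ = begin
    suc e * P + 2 + 1 + 7 * e                  ≤⟨ m≤m+n _ 7 ⟩
    suc e * P + 2 + 1 + 7 * e + 7              ≡⟨ regroup e P ⟩
    suc e * (P + 7) + 3                        ≤⟨ +-mono-≤ (*-monoˡ-≤ (P + 7) (entries-bound e L 1≤L e≤)) (*-monoʳ-≤ 3 1≤L) ⟩
    L * (2 * (α + β) + 1) * (P + 7) + 3 * L    ≡⟨ factor L (α + β) P ⟩
    C * L                                      ∎
    where
    open ≤-Reasoning
    P = precompStepCost α β
    regroup : ∀ e P → suc e * P + 2 + 1 + 7 * e + 7 ≡ suc e * (P + 7) + 3
    regroup = ℕ-Solver.solve-∀
    factor : ∀ L M P → L * (2 * M + 1) * (P + 7) + 3 * L ≡ ((2 * M + 1) * (P + 7) + 3) * L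
    factor = ℕ-Solver.solve-∀

  module Loop {a r s : Level} (O : StrictTotalOrder a r s) {n : ℕ}
              (V : Vec (StrictTotalOrder.Carrier O) n) (x : StrictTotalOrder.Carrier O) where

    -- Loop invariant for potential m: z = m - α, right is a valid index and
    -- the window [left,right] has at most G(m) items.
    Inv : ℕ → ℕ → ℕ → ℤ → Set
    Inv m left right z = z ≡ + m ℤ.- + α × right < n × right ∸ left ≤ G α β (+ m) ∸ 1

    Good : ℕ → ℕ → ℕ → ℤ → Set
    Good m left right z = Inv m left right z ⊎ right ≤ left

    Terminates : ℕ → ℕ → ℕ → ℤ → ℕ → ℕ → Set
    Terminates f left right z c B =
      ∃₂ λ out cost → searchLoop α β O f V x left right z c ≡ just (out , cost) × cost ≤ B

    -- After splitting off a part of size G(m-a), the new state is good for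
    -- potential m-a: either the invariant holds, or G(m-a) = 0 and the window is empty.
    good-after : ∀ m a {left right z} → z ≡ (+ m ℤ.- + a) ℤ.- + α → right < n →
      right ∸ left ≤ G α β (+ m ℤ.- + a) ∸ 1 → Good (m ∸ a) left right z
    good-after m a z≡ right<n width with a ≤? m
    ... | yes a≤m = inj₁ (trans z≡ (cong (ℤ._- + α) (minus-≥ a≤m)) , right<n ,
                          subst (λ t → _ ≤ t ∸ 1) (G-minus a≤m) width)
    ... | no a≰m = inj₂ (m∸n≡0⇒m≤n (n≤0⇒n≡0 (subst (λ t → _ ≤ t ∸ 1) (G-negative (minus-< (≰⇒> a≰m))) width)))

    wide-window : ∀ {m left right} → left < right → right ∸ left ≤ G α β (+ m) ∸ 1 → ℓ α β ≤ m
    wide-window {m} l<r width with m <? ℓ α β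
    ... | yes m<ℓ = ⊥-elim (<⇒≱ (m<n⇒0<n∸m l<r) (subst (λ t → _ ≤ t ∸ 1) (G-initial m<ℓ) width))
    ... | no m≮ℓ = ≮⇒≥ m≮ℓ

    potential-drops : ∀ {m left right a} → left < right → right ∸ left ≤ G α β (+ m) ∸ 1 →
      1 ≤ a → m ∸ a < m
    potential-drops l<r width 1≤a = ∸-shrinks 1≤a (≤-trans 1≤ℓ (wide-window l<r width))

    probe : ℕ → ℕ → ℕ → ℕ
    probe m left right = ((left + G α β (+ m ℤ.- + α)) ∸ 1) ⊓ right

    iteration-cost : ∀ c m m' → m' < m → c + 7 + 1 + 7 * m' ≤ c + 1 + 7 * m
    iteration-cost c m m' m'<m = begin
      c + 7 + 1 + 7 * m'   ≡⟨ rearrange c m' ⟩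
      c + 1 + 7 * suc m'   ≤⟨ +-monoʳ-≤ (c + 1) (*-monoʳ-≤ 7 m'<m) ⟩
      c + 1 + 7 * m        ∎
      where
      open ≤-Reasoning
      rearrange : ∀ c m' → c + 7 + 1 + 7 * m' ≡ c + 1 + 7 * suc m'
      rearrange = ℕ-Solver.solve-∀

    loop-runs : ∀ f m left right z c B → Good m left right z → m < f → c + 1 + 7 * m ≤ B →
      Terminates f left right z c B
    loop-runs (suc f) m left right z c B good (s≤s m≤f) budget with left <? right
    ... | no _ = left , c + 1 , refl , ≤-trans (m≤m+n _ _) budget
    loop-runs (suc f) m left right z c B (inj₂ stop) _ _ | yes l<r = ⊥-elim (<⇒≱ l<r stop)
    loop-runs (suc f) m left right .(+ m ℤ.- + α) c B (inj₁ (refl , right<n , width)) (s≤s m≤f) budget | yes l<r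
      with probe m left right <? n
    ... | no index≮n = ⊥-elim (index≮n (≤-<-trans (m⊓n≤n _ right) right<n))
    ... | yes index<n with leq? α β O x (lookup V (fromℕ< index<n))
    ...   | true = loop-runs f (m ∸ α) left (probe m left right) _ (c + 7) B
                     (good-after m α refl index<n (left-window left right _))
                     (<-≤-trans (potential-drops l<r width 1≤α) m≤f)
                     (≤-trans (iteration-cost c m _ (potential-drops l<r width 1≤α)) budget)
    ...   | false = loop-runs f (m ∸ β) (suc (probe m left right)) right _ (c + 7) B
                      (good-after m β (minus-comm (+ m) (+ α) (+ β)) right<n right-part)
                      (<-≤-trans (potential-drops l<r width 1≤β) m≤f)
                      (≤-trans (iteration-cost c m _ (potential-drops l<r width 1≤β)) budget)
      where
      -- the right part has at most G(m) - G(m-α) = G(m-β) items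
      right-part : right ∸ suc (probe m left right) ≤ G α β (+ m ℤ.- + β) ∸ 1
      right-part = ≤-trans (right-window left right (G α β (+ m ℤ.- + α)))
                     (split-width (right ∸ left) (G α β (+ m ℤ.- + α)) (G α β (+ m ℤ.- + β))
                       (subst (λ t → right ∸ left ≤ t ∸ 1) (G-rec (wide-window l<r width)) width))

    fibSearch-unfolds : ∀ {fuel k c} → findK α β fuel n 0 0 ≡ just (k , c) →
      fibSearch α β O fuel V x ≡ searchLoop α β O fuel V x 0 (n ∸ 1) (+ k ℤ.- + α) (c + 2)
    fibSearch-unfolds found rewrite found = refl

    -- G at (1+L)(α+β), L = ⌊log₂ n⌋, is at least 2^(1+L) > n, so the
    -- precomputation stops within this many entries.
    tableBound : ℕ
    tableBound = suc ⌊log₂ n ⌋ * (α + β)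

    G-exceeds-n : n ≤ G α β (+ tableBound)
    G-exceeds-n = ≤-trans (<⇒≤ (below-next-power n)) (G-doubles (suc ⌊log₂ n ⌋) tableBound ≤-refl)

    -- With fuel tableBound+1 and L ≥ 1 the whole search returns within C·L:
    -- the initial state satisfies the loop invariant for potential k.
    search-within : 1 ≤ n → 1 ≤ ⌊log₂ n ⌋ →
      ∃ λ fuel → ∃₂ λ out cost → fibSearch α β O fuel V x ≡ just (out , cost) × cost ≤ C * ⌊log₂ n ⌋
    search-within 1≤n 1≤L with findK-finds (suc tableBound) n 0 0 tableBound G-exceeds-n ≤-refl
    ... | k , k≤bound , n≤Gk , found
      with loop-runs (suc tableBound) k 0 (n ∸ 1) (+ k ℤ.- + α) (suc k * precompStepCost α β + 2) (C * ⌊log₂ n ⌋)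
             (inj₁ (refl , ∸-monoʳ-< z<s 1≤n , ∸-monoˡ-≤ 1 n≤Gk)) (s≤s k≤bound) (total-cost k ⌊log₂ n ⌋ 1≤L k≤bound)
    ... | out , cost , runs , within = suc tableBound , out , cost , trans (fibSearch-unfolds found) runs , within

-- Theorem: with N₀ = 2 (so that ⌊log₂ n⌋ ≥ 1), the search on any n-item
-- array returns with cost at most C·⌊log₂ n⌋.  The bound holds for every
-- array and query; sortedness and x ∈ V only matter for correctness.
proposition8 : (α β : ℕ) → 1 ≤ α → 1 ≤ β → {a r s : Level} →
    ∃₂ λ (C N₀ : ℕ) → (O : StrictTotalOrder a r s) → (n : ℕ) → 1 ≤ n → N₀ ≤ n →
      (V : Vec (StrictTotalOrder.Carrier O) n) → SortedVec α β O V →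
      (x : StrictTotalOrder.Carrier O) → InVec α β O x V →
      ∃ λ (fuel : ℕ) → ∃₂ λ (out cost : ℕ) →
        fibSearch α β O fuel V x ≡ just (out , cost) × cost ≤ C * ⌊log₂ n ⌋
proposition8 α β 1≤α 1≤β = C , 2 , λ O n 1≤n 2≤n V _ x _ →
  Loop.search-within O V x 1≤n (⌊log₂⌋-mono-≤ {2} {n} 2≤n)
  where open FibonacciSearch α β 1≤α 1≤β
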